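{- Let $n \ge 2$ and let $B_n = (k_1+1, k_2+1, \ldots, k_n+1)$ be a bouquet of $n$ circles with a cut-vertex. Then $Z(L(B_n)) = 2n-1$.
   Context: For integers $k_n \ge \cdots \ge k_1 \ge 2$, the bouquet $B_n = (k_1+1, \ldots, k_n+1)$ is the graph obtained from $n$ cycles $C^1, \ldots, C^n$, where $C^i$ has $k_i+1$ vertices, by identifying one vertex from each cycle into a single common vertex (so the cycles pairwise share only that vertex). $L(G)$ is the line graph of $G$. Zero forcing: each vertex of a graph $H$ is colored black or white; if a black vertex $u$ has exactly one white neighbor $w$, then $w$ becomes black (color-change rule). $S \subseteq V(H)$ is a zero forcing set if, starting with exactly $S$ black, repeated application of the rule makes every vertex black. $Z(H)$ is the minimum size of a zero forcing set of $H$. -}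

module Defs where

open import Data.Nat using (ℕ; zero; suc; _+_; _∸_; _≤_)
open import Data.Fin using (Fin)
open import Data.Fin.Subset using (Subset; _∈_; _∉_; _∪_; ⁅_⁆; ⊤; ∣_∣)
open import Data.List using (List; []; _∷_; _++_; [_]; length; lookup)
open import Data.Product using (_×_; _,_; ∃; ∃-syntax; Σ)
open import Data.Sum using (_⊎_)
open import Relation.Binary.PropositionalEquality using (_≡_; _≢_)
open import Relation.Binary.Construct.Closure.ReflexiveTransitive using (Star)

record Graph : Set₁ where
  field
    V   : ℕ
    Adj : Fin V → Fin V → Set
open Graph public

data ForceStep (H : Graph) (S : Subset (V H)) : Subset (V H) → Set where
  force : (u w : Fin (V H)) → u ∈ S → w ∉ S → Adj H u w →
          (∀ x → Adj H u x → x ≢ w → x ∈ S) →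
          ForceStep H S (S ∪ ⁅ w ⁆)

IsZeroForcingSet : (H : Graph) → Subset (V H) → Set
IsZeroForcingSet H S = Star (ForceStep H) S ⊤

ZeroForcingNumberIs : Graph → ℕ → Set
ZeroForcingNumberIs H k =
  (Σ (Subset (V H)) λ S → IsZeroForcingSet H S × ∣ S ∣ ≡ k) ×
  (∀ S → IsZeroForcingSet H S → k ≤ ∣ S ∣)

Edge : Set
Edge = ℕ × ℕ

ShareEndpoint : Edge → Edge → Set
ShareEndpoint (a , b) (c , d) = (a ≡ c ⊎ a ≡ d) ⊎ (b ≡ c ⊎ b ≡ d)

-- L(G) for G given by its (duplicate-free) edge list: vertices are the
-- edges, two distinct edges adjacent iff they share an endpoint.
LineGraph : List Edge → Graph
LineGraph es = record
  { V   = length es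
  ; Adj = λ i j → i ≢ j × ShareEndpoint (lookup es i) (lookup es j) }

-- Bouquet B_n = (k₁+1, …, kₙ+1).  Common vertex is 0; the i-th cycle
-- uses fresh vertices o+1, …, o+kᵢ (o = k₁+…+k_{i-1}) and is the cycle
-- 0, o+1, o+2, …, o+kᵢ, 0  of length kᵢ+1.

pathEdges : ℕ → ℕ → List Edge
pathEdges a zero    = []
pathEdges a (suc m) = (a , suc a) ∷ pathEdges (suc a) m

cycleEdges : ℕ → ℕ → List Edge
cycleEdges o k = ((0 , suc o) ∷ pathEdges (suc o) (k ∸ 1)) ++ [ (o + k , 0) ]

bouquetEdgesFrom : ℕ → List ℕ → List Edge
bouquetEdgesFrom o []       = []
bouquetEdgesFrom o (k ∷ ks) = cycleEdges o k ++ bouquetEdgesFrom (o + k) ks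

bouquetEdges : List ℕ → List Edge
bouquetEdges ks = bouquetEdgesFrom 0 ks

-- The 2n edges at the centre of the bouquet are pairwise adjacent in its line graph;
-- every other edge meets only its two neighbours on its cycle.  For a set T of black
-- edges let Φ(T) be the sum over the cycles C of min(2, |T ∩ C|), so Φ(T) ≤ |T|.
-- A force from a non-central edge u needs u and its other neighbour black, so the
-- cycle of u already has two black edges and Φ does not change.  A force from a
-- central edge needs all central edges but one black; each cycle has exactly two of
-- them, so then Φ ≥ 2n - 1.  As Φ of all edges is 2n, every zero forcing set has
-- Φ ≥ 2n - 1.  Conversely the first two edges of every cycle but the last, together
-- with the last edge of the last cycle, force all edges one by one along the walk.

module Submission where

open import Defs
open import Algebra.Properties.CommutativeSemigroup using (interchange)
open import Data.Bool using (Bool; true; false; _∧_; _∨_)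
open import Data.Bool.Properties
  using (∨-identityʳ; ∨-zeroʳ; ∨-assoc; ∨-comm; ∨-conicalˡ; ∨-conicalʳ; ∧-identityʳ; ∧-zeroʳ)
open import Data.Empty using (⊥-elim)
open import Data.Fin using (Fin; toℕ; fromℕ<) renaming (zero to fzero; suc to fsuc)
open import Data.Fin.Properties using (toℕ-fromℕ<; toℕ-injective; toℕ<n)
open import Data.Fin.Subset using (Subset; _∈_; _∉_; _∪_; ⁅_⁆; ⊤; ∣_∣)
open import Data.Fin.Subset.Properties using (∪-identityʳ)
open import Data.List as List using (List; []; _∷_; _++_; [_]; length; applyUpTo)
open import Data.List.Properties using (length-applyUpTo; lookup-applyUpTo; applyUpTo-∷ʳ)
open import Data.List.Relation.Unary.All using (All; []; _∷_)
open import Data.Nat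
open import Data.Nat.Properties
open import Data.Nat.Tactic.RingSolver using (solve-∀)
open import Data.Product using (Σ; _×_; _,_; proj₁)
open import Data.Sum using (_⊎_; inj₁; inj₂)
open import Data.Vec using (Vec; []; _∷_; here; there; lookup; toList)
open import Data.Vec.Properties using (length-toList)
open import Function using (_∘_)
open import Relation.Binary.Construct.Closure.ReflexiveTransitive using (Star; ε; _◅_)
open import Relation.Binary.PropositionalEquality hiding ([_])
open import Relation.Nullary using (does; yes; no)
open import Relation.Nullary.Decidable using (dec-true; dec-false)

true≢false : true ≢ false
true≢false ()

∨-introˡ : ∀ {a} b → a ≡ true → (a ∨ b) ≡ true
∨-introˡ b refl = refl

∨-introʳ : ∀ a {b} → b ≡ true → (a ∨ b) ≡ true
∨-introʳ a refl = ∨-zeroʳ a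

∧-intro : ∀ {a b} → a ≡ true → b ≡ true → (a ∧ b) ≡ true
∧-intro refl refl = refl

bit : Bool → ℕ
bit false = 0
bit true  = 1

bit≤1 : ∀ b → bit b ≤ 1
bit≤1 false = z≤n
bit≤1 true  = ≤-refl

isZero : ℕ → Bool
isZero zero    = true
isZero (suc _) = false

isZero-≡0 : ∀ {x} → x ≡ 0 → isZero x ≡ true
isZero-≡0 refl = refl

isZero-false⇒≢0 : ∀ {x} → isZero x ≡ false → x ≢ 0
isZero-false⇒≢0 {zero}  ()
isZero-false⇒≢0 {suc x} _ ()

isZero-≢0 : ∀ {x} → x ≢ 0 → isZero x ≡ false
isZero-≢0 {zero}  x≢0 = ⊥-elim (x≢0 refl)
isZero-≢0 {suc x} _   = refl

count : ℕ → (ℕ → Bool) → ℕ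
count zero    f = 0
count (suc m) f = bit (f 0) + count m (f ∘ suc)

count-cong : ∀ m {f g} → (∀ i → i < m → f i ≡ g i) → count m f ≡ count m g
count-cong zero    f≗g = refl
count-cong (suc m) f≗g = cong₂ _+_ (cong bit (f≗g 0 z<s)) (count-cong m (λ i i<m → f≗g (suc i) (s<s i<m)))

count-zero : ∀ m {f} → (∀ i → i < m → f i ≡ false) → count m f ≡ 0
count-zero zero    f≡false = refl
count-zero (suc m) f≡false rewrite f≡false 0 z<s = count-zero m (λ i i<m → f≡false (suc i) (s<s i<m))

count-++ : ∀ a b f → count (a + b) f ≡ count a f + count b (λ i → f (a + i))
count-++ zero    b f = refl
count-++ (suc a) b f rewrite count-++ a b (f ∘ suc) = sym (+-assoc (bit (f 0)) _ _)

count-snoc : ∀ m f → count (suc m) f ≡ count m f + bit (f m)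
count-snoc zero    f = +-comm (bit (f 0)) 0
count-snoc (suc m) f = trans (cong (bit (f 0) +_) (count-snoc m (f ∘ suc))) (sym (+-assoc (bit (f 0)) _ _))

count-shift : ∀ m f → count m (f ∘ suc) + bit (f 0) ≡ count m f + bit (f m)
count-shift m f = trans (+-comm (count m (f ∘ suc)) _) (count-snoc m f)

count-mono : ∀ m {f g} → (∀ i → i < m → f i ≡ true → g i ≡ true) → count m f ≤ count m g
count-mono zero    f⇒g = z≤n
count-mono (suc m) {f} {g} f⇒g with f 0 in f0
... | true  rewrite f⇒g 0 z<s f0 = s≤s (count-mono m (λ i i<m → f⇒g (suc i) (s<s i<m)))
... | false = ≤-trans (count-mono m (λ i i<m → f⇒g (suc i) (s<s i<m))) (m≤n+m _ (bit (g 0)))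

count-∨ : ∀ m f g → count m (λ i → f i ∨ g i) ≤ count m f + count m g
count-∨ zero    f g = z≤n
count-∨ (suc m) f g = begin
  bit (f 0 ∨ g 0) + count m (λ i → f (suc i) ∨ g (suc i))
    ≤⟨ +-mono-≤ (bit-∨ (f 0) (g 0)) (count-∨ m (f ∘ suc) (g ∘ suc)) ⟩
  (bit (f 0) + bit (g 0)) + (count m (f ∘ suc) + count m (g ∘ suc))
    ≡⟨ interchange +-commutativeSemigroup (bit (f 0)) (bit (g 0)) _ _ ⟩
  count (suc m) f + count (suc m) g ∎
  where
  open ≤-Reasoning
  bit-∨ : ∀ a b → bit (a ∨ b) ≤ bit a + bit b
  bit-∨ false b = ≤-refl
  bit-∨ true  b = s≤s z≤n

count-∨-disjoint : ∀ m f g → (∀ i → i < m → (f i ∧ g i) ≡ false) →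
                   count m (λ i → f i ∨ g i) ≡ count m f + count m g
count-∨-disjoint zero    f g disj = refl
count-∨-disjoint (suc m) f g disj with f 0 | g 0 | disj 0 z<s
... | true  | false | _ = cong suc (count-∨-disjoint m (f ∘ suc) (g ∘ suc) (λ i i<m → disj (suc i) (s<s i<m)))
... | false | true  | _ = trans (cong suc (count-∨-disjoint m (f ∘ suc) (g ∘ suc) (λ i i<m → disj (suc i) (s<s i<m))))
                                (sym (+-suc _ _))
... | false | false | _ = count-∨-disjoint m (f ∘ suc) (g ∘ suc) (λ i i<m → disj (suc i) (s<s i<m))

count≤ : ∀ m f → count m f ≤ m
count≤ zero    f = z≤n
count≤ (suc m) f = +-mono-≤ (bit≤1 (f 0)) (count≤ m (f ∘ suc))

lastTrue : ∀ m (f : ℕ → Bool) → 0 < m → f 0 ≡ true →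
           Σ ℕ λ M → M < m × f M ≡ true × (∀ i → M < i → i < m → f i ≡ false)
lastTrue (suc zero)    f _ f0 = 0 , z<s , f0 , λ i 0<i i<1 → ⊥-elim (<⇒≱ 0<i (≤-pred i<1))
lastTrue (suc (suc m)) f _ f0 with lastTrue (suc m) f z<s f0 | f (suc m) in f[1+m]
... | _                      | true  = suc m , ≤-refl , f[1+m] , λ i 1+m<i i<2+m → ⊥-elim (<⇒≱ 1+m<i (≤-pred i<2+m))
... | M , M<1+m , fM , after | false = M , m<n⇒m<1+n M<1+m , fM , later
  where
  later : ∀ i → M < i → i < suc (suc m) → f i ≡ false
  later i M<i i<2+m with i ≟ suc m
  ... | yes refl   = f[1+m]
  ... | no  i≢1+m = after i M<i (≤∧≢⇒< (≤-pred i<2+m) i≢1+m)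

count-≟≤1 : ∀ m k → count m (λ i → does (i ≟ k)) ≤ 1
count-≟≤1 zero    k       = z≤n
count-≟≤1 (suc m) zero    = ≤-reflexive (cong suc (count-zero m (λ _ _ → refl)))
count-≟≤1 (suc m) (suc k) = count-≟≤1 m k

count-<?-∧ : ∀ M L f → M ≤ L → count L (λ i → does (i <? M) ∧ f i) ≡ count M f
count-<?-∧ zero    L       f _         = count-zero L (λ _ _ → refl)
count-<?-∧ (suc M) (suc L) f (s≤s M≤L) = cong (bit (f 0) +_) (count-<?-∧ M L (f ∘ suc) M≤L)

<?-suc : ∀ i z → does (i <? suc z) ≡ does (i <? z) ∨ does (i ≟ z)
<?-suc zero    zero    = refl
<?-suc zero    (suc z) = refl
<?-suc (suc i) zero    = refl
<?-suc (suc i) (suc z) = <?-suc i z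

count≤count-∧-except : ∀ m (q t : ℕ → Bool) w → (∀ i → i < m → q i ≡ true → i ≢ w → t i ≡ true) →
                       count m q ≤ suc (count m (λ i → t i ∧ q i))
count≤count-∧-except m q t w t-on-q = begin
  count m q
    ≤⟨ count-mono m q⇒ ⟩
  count m (λ i → (t i ∧ q i) ∨ does (i ≟ w))
    ≤⟨ count-∨ m (λ i → t i ∧ q i) (λ i → does (i ≟ w)) ⟩
  count m (λ i → t i ∧ q i) + count m (λ i → does (i ≟ w))
    ≤⟨ +-monoʳ-≤ _ (count-≟≤1 m w) ⟩
  count m (λ i → t i ∧ q i) + 1
    ≡⟨ +-comm _ 1 ⟩
  suc (count m (λ i → t i ∧ q i)) ∎
  where
  open ≤-Reasoning
  q⇒ : ∀ i → i < m → q i ≡ true → ((t i ∧ q i) ∨ does (i ≟ w)) ≡ true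
  q⇒ i i<m qi with i ≟ w
  ... | yes i≡w = ∨-introʳ (t i ∧ q i) (dec-true (i ≟ w) i≡w)
  ... | no  i≢w = ∨-introˡ (does (i ≟ w)) (∧-intro (t-on-q i i<m qi i≢w) qi)

closeBlock : Bool → ℕ → ℕ → ℕ
closeBlock true  c x = c + x
closeBlock false c x = x

carry : Bool → ℕ → Bool → ℕ
carry true  c b = bit b
carry false c b = 2 ⊓ (c + bit b)

-- weight m s t c cuts 0, …, m-1 into blocks, one starting at each i with s i, and
-- sums min(2, #{i | t i}) over the blocks; c is the capped count of a block that is
-- already open at 0.
weight : ℕ → (ℕ → Bool) → (ℕ → Bool) → ℕ → ℕ
weight zero    s t c = c
weight (suc m) s t c = closeBlock (s 0) c (weight m (s ∘ suc) (t ∘ suc) (carry (s 0) c (t 0)))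

weight-cong : ∀ m s {t t′} c → (∀ i → i < m → t i ≡ t′ i) → weight m s t c ≡ weight m s t′ c
weight-cong zero    s c t≗t′ = refl
weight-cong (suc m) s c t≗t′ rewrite t≗t′ 0 z<s =
  cong (closeBlock (s 0) c) (weight-cong m (s ∘ suc) _ (λ i i<m → t≗t′ (suc i) (s<s i<m)))

weight≤count : ∀ m s t c → weight m s t c ≤ c + count m t
weight≤count zero    s t c = ≤-reflexive (sym (+-identityʳ c))
weight≤count (suc m) s t c with s 0
... | true  = +-monoʳ-≤ c (weight≤count m (s ∘ suc) (t ∘ suc) (bit (t 0)))
... | false = begin
  weight m (s ∘ suc) (t ∘ suc) (2 ⊓ (c + bit (t 0)))   ≤⟨ weight≤count m (s ∘ suc) (t ∘ suc) _ ⟩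
  2 ⊓ (c + bit (t 0)) + count m (t ∘ suc)               ≤⟨ +-monoˡ-≤ _ (m⊓n≤n 2 (c + bit (t 0))) ⟩
  c + bit (t 0) + count m (t ∘ suc)                     ≡⟨ +-assoc c _ _ ⟩
  c + count (suc m) t                                   ∎
  where open ≤-Reasoning

boundary : (ℕ → Bool) → ℕ → Bool
boundary s i = s i ∨ s (suc i)

NoAdjacentStarts : ℕ → (ℕ → Bool) → Set
NoAdjacentStarts m s = ∀ i → i < m → s i ≡ true → s (suc i) ≡ false

private
  noAdjacent-suc : ∀ {m s} → NoAdjacentStarts (suc m) s → NoAdjacentStarts m (s ∘ suc)
  noAdjacent-suc noAdj i i<m = noAdj (suc i) (s<s i<m)

mutual
  count-boundary≤weight : ∀ m s t c → s 0 ≡ true → NoAdjacentStarts m s →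
                          c + count m (λ i → t i ∧ boundary s i) ≤ weight m s t c
  count-boundary≤weight zero    s t c s0 noAdj = ≤-reflexive (+-identityʳ c)
  count-boundary≤weight (suc m) s t c s0 noAdj rewrite s0 | ∧-identityʳ (t 0) =
    +-monoʳ-≤ c (count-boundary≤weight-inBlock m (s ∘ suc) (t ∘ suc) (bit (t 0)) (bit (t 0))
                   (noAdj 0 z<s s0) (noAdjacent-suc noAdj) ≤-refl (bit≤1 (t 0)))

  -- b is the contribution of the first position of the open block, counted in c.
  count-boundary≤weight-inBlock : ∀ m s t c b → s 0 ≡ false → NoAdjacentStarts m s → b ≤ c → b ≤ 1 →
                                  b + count m (λ i → t i ∧ boundary s i) ≤ weight m s t c
  count-boundary≤weight-inBlock zero    s t c b s0 noAdj b≤c b≤1 = ≤-trans (≤-reflexive (+-identityʳ b)) b≤c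
  count-boundary≤weight-inBlock (suc m) s t c b s0 noAdj b≤c b≤1 rewrite s0 with s 1 in s1
  ... | true rewrite ∧-identityʳ (t 0) = begin
    b + (bit (t 0) + count m _)  ≡⟨ +-assoc b (bit (t 0)) _ ⟨
    b + bit (t 0) + count m _    ≤⟨ +-monoˡ-≤ _ (⊓-glb (+-mono-≤ b≤1 (bit≤1 (t 0))) (+-monoˡ-≤ (bit (t 0)) b≤c)) ⟩
    2 ⊓ (c + bit (t 0)) + count m _
      ≤⟨ count-boundary≤weight m (s ∘ suc) (t ∘ suc) _ s1 (noAdjacent-suc noAdj) ⟩
    weight m (s ∘ suc) (t ∘ suc) (2 ⊓ (c + bit (t 0))) ∎
    where open ≤-Reasoning
  ... | false rewrite ∧-zeroʳ (t 0) =
    count-boundary≤weight-inBlock m (s ∘ suc) (t ∘ suc) _ b s1 (noAdjacent-suc noAdj)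
      (⊓-glb (≤-trans b≤1 (s≤s z≤n)) (≤-trans b≤c (m≤m+n c _))) b≤1

carry-≥-bit : ∀ s c b → bit b ≤ carry s c b
carry-≥-bit true  c b = ≤-refl
carry-≥-bit false c b = ⊓-glb (≤-trans (bit≤1 b) (s≤s z≤n)) (m≤n+m (bit b) c)

private
  weight-three : ∀ m s t c → s 1 ≡ false → s 2 ≡ false →
    weight (3 + m) s t c ≡
    closeBlock (s 0) c (weight m (s ∘ (3 +_)) (t ∘ (3 +_))
                         (2 ⊓ (2 ⊓ (carry (s 0) c (t 0) + bit (t 1)) + bit (t 2))))
  weight-three m s t c s1 s2 rewrite s1 | s2 = refl

  capped-twice : ∀ x b → 1 ≤ x ⊎ b ≡ true → 2 ⊓ (2 ⊓ (x + 1) + bit b) ≡ 2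
  capped-twice x b (inj₁ 1≤x) rewrite m≤n⇒m⊓n≡m (+-monoˡ-≤ 1 1≤x) = m≤n⇒m⊓n≡m (m≤m+n 2 (bit b))
  capped-twice x b (inj₂ refl) = m≤n⇒m⊓n≡m (+-monoˡ-≤ 1 (⊓-glb (s≤s z≤n) (m≤n+m 1 x)))

-- Edges j, j+1, j+2 lie in one block and at least two of them stay black, so the
-- count of that block is capped at 2 whatever the colour of w.
weight-recolour-saturated : ∀ j m s t t′ c w → suc (suc j) < m →
  s (suc j) ≡ false → s (suc (suc j)) ≡ false → t (suc j) ≡ true →
  (w ≡ j × t (suc (suc j)) ≡ true) ⊎ (w ≡ suc (suc j) × t j ≡ true) →
  (∀ i → i ≢ w → t′ i ≡ t i) → weight m s t′ c ≡ weight m s t c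
weight-recolour-saturated zero (suc (suc (suc m))) s t t′ c w _ s1 s2 t1 black-pair t′≗t
  rewrite weight-three m s t c s1 s2 | weight-three m s t′ c s1 s2 =
  cong (closeBlock (s 0) c) (begin
    weight m _ (t′ ∘ (3 +_)) (2 ⊓ (2 ⊓ (carry (s 0) c (t′ 0) + bit (t′ 1)) + bit (t′ 2)))
      ≡⟨ cong (weight m _ (t′ ∘ (3 +_))) (trans (saturated t′ (trans (t′≗t 1 (1≢w black-pair)) t1) (transfer black-pair))
                                                  (sym (saturated t t1 black-pair))) ⟩
    weight m _ (t′ ∘ (3 +_)) (2 ⊓ (2 ⊓ (carry (s 0) c (t 0) + bit (t 1)) + bit (t 2)))
      ≡⟨ weight-cong m _ _ (λ i _ → t′≗t (3 + i) (3+i≢w black-pair)) ⟩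
    weight m _ (t ∘ (3 +_)) (2 ⊓ (2 ⊓ (carry (s 0) c (t 0) + bit (t 1)) + bit (t 2))) ∎)
  where
  open ≡-Reasoning
  saturated : ∀ (u : ℕ → Bool) → u 1 ≡ true → (w ≡ 0 × u 2 ≡ true) ⊎ (w ≡ 2 × u 0 ≡ true) →
              2 ⊓ (2 ⊓ (carry (s 0) c (u 0) + bit (u 1)) + bit (u 2)) ≡ 2
  saturated u u1 (inj₁ (_ , u2)) rewrite u1 = capped-twice _ (u 2) (inj₂ u2)
  saturated u u1 (inj₂ (_ , u0)) rewrite u1 =
    capped-twice _ (u 2) (inj₁ (≤-trans (≤-reflexive (cong bit (sym u0))) (carry-≥-bit (s 0) c (u 0))))
  1≢w : (w ≡ 0 × t 2 ≡ true) ⊎ (w ≡ 2 × t 0 ≡ true) → 1 ≢ w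
  1≢w (inj₁ (refl , _)) ()
  1≢w (inj₂ (refl , _)) ()
  3+i≢w : ∀ {i} → (w ≡ 0 × t 2 ≡ true) ⊎ (w ≡ 2 × t 0 ≡ true) → 3 + i ≢ w
  3+i≢w (inj₁ (refl , _)) ()
  3+i≢w (inj₂ (refl , _)) ()
  transfer : (w ≡ 0 × t 2 ≡ true) ⊎ (w ≡ 2 × t 0 ≡ true) → (w ≡ 0 × t′ 2 ≡ true) ⊎ (w ≡ 2 × t′ 0 ≡ true)
  transfer (inj₁ (refl , t2)) = inj₁ (refl , trans (t′≗t 2 (λ ())) t2)
  transfer (inj₂ (refl , t0)) = inj₂ (refl , trans (t′≗t 0 (λ ())) t0)
weight-recolour-saturated zero    zero                _ _ _ _ _ ()
weight-recolour-saturated zero    (suc zero)          _ _ _ _ _ (s<s ())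
weight-recolour-saturated zero    (suc (suc zero))    _ _ _ _ _ (s<s (s<s ()))
weight-recolour-saturated (suc j) (suc m) s t t′ c zero _ _ _ _ (inj₁ (() , _)) _
weight-recolour-saturated (suc j) (suc m) s t t′ c zero _ _ _ _ (inj₂ (() , _)) _
weight-recolour-saturated (suc j) (suc m) s t t′ c (suc w) (s<s ssj<m) s1 s2 t1 black-pair t′≗t
  rewrite t′≗t 0 (λ ()) =
  cong (closeBlock (s 0) c)
    (weight-recolour-saturated j m (s ∘ suc) (t ∘ suc) (t′ ∘ suc) _ w ssj<m s1 s2 t1 (pred-pair black-pair)
       (λ i i≢w → t′≗t (suc i) (i≢w ∘ suc-injective)))
  where
  pred-pair : (suc w ≡ suc j × t (3 + j) ≡ true) ⊎ (suc w ≡ 3 + j × t (suc j) ≡ true) →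
              (w ≡ j × t (3 + j) ≡ true) ⊎ (w ≡ suc (suc j) × t (suc j) ≡ true)
  pred-pair (inj₁ (e , b)) = inj₁ (suc-injective e , b)
  pred-pair (inj₂ (e , b)) = inj₂ (suc-injective e , b)

χ : ∀ {L} → Subset L → ℕ → Bool
χ []      i       = false
χ (b ∷ T) zero    = b
χ (b ∷ T) (suc i) = χ T i

∈⇒χ : ∀ {L} {x : Fin L} {T} → x ∈ T → χ T (toℕ x) ≡ true
∈⇒χ here      = refl
∈⇒χ (there p) = ∈⇒χ p

χ⇒∈ : ∀ {L} (x : Fin L) T → χ T (toℕ x) ≡ true → x ∈ T
χ⇒∈ fzero    (true ∷ T) _  = here
χ⇒∈ (fsuc x) (b ∷ T)    χx = there (χ⇒∈ x T χx)

∣∣≡count-χ : ∀ {L} (T : Subset L) → ∣ T ∣ ≡ count L (χ T)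
∣∣≡count-χ []          = refl
∣∣≡count-χ (true ∷ T)  = cong suc (∣∣≡count-χ T)
∣∣≡count-χ (false ∷ T) = ∣∣≡count-χ T

χ-∪-⁅⁆ : ∀ {L} (T : Subset L) w i → χ (T ∪ ⁅ w ⁆) i ≡ χ T i ∨ does (i ≟ toℕ w)
χ-∪-⁅⁆ (b ∷ T) fzero    zero    = refl
χ-∪-⁅⁆ (b ∷ T) fzero    (suc i) = trans (cong (λ U → χ U i) (∪-identityʳ T)) (sym (∨-identityʳ _))
χ-∪-⁅⁆ (b ∷ T) (fsuc w) zero    = refl
χ-∪-⁅⁆ (b ∷ T) (fsuc w) (suc i) = χ-∪-⁅⁆ T w i

χ-⊤ : ∀ L i → i < L → χ (⊤ {L}) i ≡ true
χ-⊤ (suc L) zero    _         = refl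
χ-⊤ (suc L) (suc i) (s<s i<L) = χ-⊤ L i i<L

χ-injective : ∀ {L} (T U : Subset L) → (∀ i → i < L → χ T i ≡ χ U i) → T ≡ U
χ-injective []      []      _   = refl
χ-injective (b ∷ T) (c ∷ U) T≗U = cong₂ _∷_ (T≗U 0 z<s) (χ-injective T U (λ i i<L → T≗U (suc i) (s<s i<L)))

fromPred : (L : ℕ) → (ℕ → Bool) → Subset L
fromPred zero    f = []
fromPred (suc L) f = f 0 ∷ fromPred L (f ∘ suc)

χ-fromPred : ∀ L f i → i < L → χ (fromPred L f) i ≡ f i
χ-fromPred (suc L) f zero    _         = refl
χ-fromPred (suc L) f (suc i) (s<s i<L) = χ-fromPred L (f ∘ suc) i i<L

-- es lists the edges of the closed walk v 0, v 1, …, v L from the hub 0 back to it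
-- (v is the hub beyond L).  Every other vertex is visited at most once, so the walk
-- runs once around each of the n cycles of a bouquet, and the cycles are the blocks
-- of hubAt.
module HubWalk
  (es : List Edge) (v : ℕ → ℕ) (n : ℕ)
  (edge-lookup   : ∀ i → List.lookup es i ≡ (v (toℕ i) , v (suc (toℕ i))))
  (starts-at-hub : v 0 ≡ 0)
  (hub-beyond    : ∀ j → length es ≤ j → v j ≡ 0)
  (visits-once   : ∀ i j → v i ≡ v j → v i ≢ 0 → i ≡ j)
  (no-hub-loop   : NoAdjacentStarts (length es) (isZero ∘ v))
  (hub-visits    : count (length es) (isZero ∘ v) ≡ n)
  (2≤n           : 2 ≤ n)
  where

  L : ℕ
  L = length es

  H : Graph
  H = LineGraph es

  hubAt : ℕ → Bool
  hubAt = isZero ∘ v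

  Meet : ℕ → ℕ → Set
  Meet i j = ShareEndpoint (v i , v (suc i)) (v j , v (suc j))

  adjacent⇒meet : ∀ {u x} → Adj H u x → Meet (toℕ u) (toℕ x)
  adjacent⇒meet {u} {x} (_ , share) rewrite edge-lookup u | edge-lookup x = share

  meet⇒adjacent : ∀ {u x} → toℕ u ≢ toℕ x → Meet (toℕ u) (toℕ x) → Adj H u x
  meet⇒adjacent {u} {x} u≢x meet rewrite edge-lookup u | edge-lookup x = u≢x ∘ cong toℕ , meet

  nonHub⇒<L : ∀ j → v j ≢ 0 → j < L
  nonHub⇒<L j vj≢0 with j <? L
  ... | yes j<L = j<L
  ... | no  j≮L = ⊥-elim (vj≢0 (hub-beyond j (≮⇒≥ j≮L)))

  data Meeting (i j : ℕ) : Set where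
    same  : i ≡ j → Meeting i j
    next  : suc i ≡ j → Meeting i j
    prev  : suc j ≡ i → Meeting i j
    atHub : boundary hubAt i ≡ true → boundary hubAt j ≡ true → Meeting i j

  meeting : ∀ i j → Meet i j → Meeting i j
  meeting i j (inj₁ (inj₁ e)) with v i ≟ 0
  ... | yes vi≡0 = atHub (∨-introˡ _ (isZero-≡0 vi≡0)) (∨-introˡ _ (isZero-≡0 (trans (sym e) vi≡0)))
  ... | no  vi≢0 = same (visits-once i j e vi≢0)
  meeting i j (inj₁ (inj₂ e)) with v i ≟ 0
  ... | yes vi≡0 = atHub (∨-introˡ _ (isZero-≡0 vi≡0)) (∨-introʳ _ (isZero-≡0 (trans (sym e) vi≡0)))
  ... | no  vi≢0 = prev (sym (visits-once i (suc j) e vi≢0))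
  meeting i j (inj₂ (inj₁ e)) with v (suc i) ≟ 0
  ... | yes v≡0 = atHub (∨-introʳ _ (isZero-≡0 v≡0)) (∨-introˡ _ (isZero-≡0 (trans (sym e) v≡0)))
  ... | no  v≢0 = next (visits-once (suc i) j e v≢0)
  meeting i j (inj₂ (inj₂ e)) with v (suc i) ≟ 0
  ... | yes v≡0 = atHub (∨-introʳ _ (isZero-≡0 v≡0)) (∨-introʳ _ (isZero-≡0 (trans (sym e) v≡0)))
  ... | no  v≢0 = same (suc-injective (visits-once (suc i) (suc j) e v≢0))

  boundary⇒hubEnd : ∀ i → boundary hubAt i ≡ true → v i ≡ 0 ⊎ v (suc i) ≡ 0
  boundary⇒hubEnd i b with v i
  ... | zero  = inj₁ refl
  ... | suc _ with v (suc i)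
  ...   | zero  = inj₂ refl

  boundary-meet : ∀ i j → boundary hubAt i ≡ true → boundary hubAt j ≡ true → Meet i j
  boundary-meet i j bi bj with boundary⇒hubEnd i bi | boundary⇒hubEnd j bj
  ... | inj₁ vi | inj₁ vj = inj₁ (inj₁ (trans vi (sym vj)))
  ... | inj₁ vi | inj₂ vj = inj₁ (inj₂ (trans vi (sym vj)))
  ... | inj₂ vi | inj₁ vj = inj₂ (inj₁ (trans vi (sym vj)))
  ... | inj₂ vi | inj₂ vj = inj₂ (inj₂ (trans vi (sym vj)))

  hubAt-0 : hubAt 0 ≡ true
  hubAt-0 = isZero-≡0 starts-at-hub

  count-hubAt-suc : count L (hubAt ∘ suc) ≡ n
  count-hubAt-suc = +-cancelʳ-≡ 1 _ _ (begin
    count L (hubAt ∘ suc) + 1           ≡⟨ cong (λ b → count L (hubAt ∘ suc) + bit b) hubAt-0 ⟨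
    count L (hubAt ∘ suc) + bit (hubAt 0) ≡⟨ count-shift L hubAt ⟩
    count L hubAt + bit (hubAt L)       ≡⟨ cong₂ (λ c b → c + bit b) hub-visits (isZero-≡0 (hub-beyond L ≤-refl)) ⟩
    n + 1                               ∎)
    where open ≡-Reasoning

  count-boundary : count L (boundary hubAt) ≡ 2 * n
  count-boundary = begin
    count L (boundary hubAt)                   ≡⟨ count-∨-disjoint L hubAt (hubAt ∘ suc) disjoint ⟩
    count L hubAt + count L (hubAt ∘ suc)      ≡⟨ cong₂ _+_ hub-visits count-hubAt-suc ⟩
    n + n                                      ≡⟨ cong (n +_) (+-identityʳ n) ⟨
    2 * n                                      ∎
    where
    open ≡-Reasoning
    disjoint : ∀ i → i < L → (hubAt i ∧ hubAt (suc i)) ≡ false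
    disjoint i i<L with hubAt i in hi
    ... | true  = no-hub-loop i i<L hi
    ... | false = refl

  neighbours-black : ∀ T (u w : Fin L) → (∀ x → Adj H u x → x ≢ w → x ∈ T) →
                     ∀ i → i < L → i ≢ toℕ u → i ≢ toℕ w → Meet (toℕ u) i → χ T i ≡ true
  neighbours-black T u w others-black i i<L i≢u i≢w meet =
    subst (λ k → χ T k ≡ true) x≡i (∈⇒χ (others-black x u~x (λ x≡w → i≢w (trans (sym x≡i) (cong toℕ x≡w)))))
    where
    x : Fin L
    x = fromℕ< i<L
    x≡i : toℕ x ≡ i
    x≡i = toℕ-fromℕ< i<L
    u~x : Adj H u x
    u~x = meet⇒adjacent (λ u≡x → i≢u (trans (sym x≡i) (sym u≡x))) (subst (Meet (toℕ u)) (sym x≡i) meet)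

  Φ : Subset L → ℕ
  Φ T = weight L hubAt (χ T) 0

  Φ≤∣∣ : ∀ T → Φ T ≤ ∣ T ∣
  Φ≤∣∣ T = ≤-trans (weight≤count L hubAt (χ T) 0) (≤-reflexive (sym (∣∣≡count-χ T)))

  boundary-black-except⇒2n∸1≤Φ : ∀ T w → (∀ i → i < L → boundary hubAt i ≡ true → i ≢ w → χ T i ≡ true) →
                                  2 * n ∸ 1 ≤ Φ T
  boundary-black-except⇒2n∸1≤Φ T w black = ∸-monoˡ-≤ 1 (begin
    2 * n                                              ≡⟨ count-boundary ⟨
    count L (boundary hubAt)                           ≤⟨ count≤count-∧-except L (boundary hubAt) (χ T) w black ⟩
    suc (count L (λ i → χ T i ∧ boundary hubAt i))     ≤⟨ s≤s (count-boundary≤weight L hubAt (χ T) 0 hubAt-0 no-hub-loop) ⟩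
    suc (Φ T)                                          ∎)
    where
    open ≤-Reasoning

  force-from-boundary⇒2n∸1≤Φ : ∀ T (u w : Fin L) → u ∈ T → (∀ x → Adj H u x → x ≢ w → x ∈ T) →
                               boundary hubAt (toℕ u) ≡ true → 2 * n ∸ 1 ≤ Φ T
  force-from-boundary⇒2n∸1≤Φ T u w u∈T others-black bu =
    boundary-black-except⇒2n∸1≤Φ T (toℕ w) black
    where
    black : ∀ i → i < L → boundary hubAt i ≡ true → i ≢ toℕ w → χ T i ≡ true
    black i i<L bi i≢w with i ≟ toℕ u
    ... | yes refl = ∈⇒χ u∈T
    ... | no  i≢u  = neighbours-black T u w others-black i i<L i≢u i≢w (boundary-meet (toℕ u) i bu bi)

  force-inside-block-preserves-Φ : ∀ T (u w : Fin L) → u ∈ T → Adj H u w → (∀ x → Adj H u x → x ≢ w → x ∈ T) →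
                                   boundary hubAt (toℕ u) ≡ false → Φ (T ∪ ⁅ w ⁆) ≡ Φ T
  force-inside-block-preserves-Φ T u w u∈T u~w others-black = inside (toℕ u) refl
    where
    inside : ∀ U → toℕ u ≡ U → boundary hubAt U ≡ false → Φ (T ∪ ⁅ w ⁆) ≡ Φ T
    inside zero    _  b0 = ⊥-elim (true≢false (trans (sym (∨-introˡ _ hubAt-0)) b0))
    inside (suc j) u≡ bu = byMeeting (meeting (suc j) (toℕ w) (subst (λ U → Meet U (toℕ w)) u≡ (adjacent⇒meet u~w)))
      where
      hub₁ : hubAt (suc j) ≡ false
      hub₁ = ∨-conicalˡ _ _ bu
      hub₂ : hubAt (suc (suc j)) ≡ false
      hub₂ = ∨-conicalʳ _ _ bu
      ssj<L : suc (suc j) < L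
      ssj<L = nonHub⇒<L (suc (suc j)) (isZero-false⇒≢0 hub₂)
      j<L : j < L
      j<L = <-trans (n<1+n j) (<-trans (n<1+n (suc j)) ssj<L)
      saturated : (toℕ w ≡ j × χ T (suc (suc j)) ≡ true) ⊎ (toℕ w ≡ suc (suc j) × χ T j ≡ true) →
                  Φ (T ∪ ⁅ w ⁆) ≡ Φ T
      saturated pair = weight-recolour-saturated j L hubAt (χ T) (χ (T ∪ ⁅ w ⁆)) 0 (toℕ w) ssj<L hub₁ hub₂
        (subst (λ U → χ T U ≡ true) u≡ (∈⇒χ u∈T)) pair
        (λ i i≢w → trans (χ-∪-⁅⁆ T w i) (trans (cong (χ T i ∨_) (dec-false (i ≟ toℕ w) i≢w)) (∨-identityʳ _)))
      byMeeting : Meeting (suc j) (toℕ w) → Φ (T ∪ ⁅ w ⁆) ≡ Φ T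
      byMeeting (same e)    = ⊥-elim (proj₁ u~w (toℕ-injective (trans u≡ e)))
      byMeeting (atHub b _) = ⊥-elim (true≢false (trans (sym b) bu))
      byMeeting (prev e)    = saturated (inj₁ (suc-injective e ,
        neighbours-black T u w others-black (suc (suc j)) ssj<L
          (λ e′ → 1+n≢n (trans e′ u≡)) (λ e′ → m+1+n≢n 1 (trans e′ (suc-injective e)))
          (subst (λ U → Meet U (suc (suc j))) (sym u≡) (inj₂ (inj₁ refl)))))
      byMeeting (next e)    = saturated (inj₂ (sym e ,
        neighbours-black T u w others-black j j<L
          (λ e′ → 1+n≢n (sym (trans e′ u≡))) (λ e′ → m+1+n≢n 1 (sym (trans e′ (sym e))))
          (subst (λ U → Meet U j) (sym u≡) (inj₁ (inj₂ refl)))))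

  2n∸1≤Φ : ∀ T → Star (ForceStep H) T ⊤ → 2 * n ∸ 1 ≤ Φ T
  2n∸1≤Φ _ ε = boundary-black-except⇒2n∸1≤Φ ⊤ 0 (λ i i<L _ _ → χ-⊤ L i i<L)
  2n∸1≤Φ T (force u w u∈T _ u~w others-black ◅ rest) with boundary hubAt (toℕ u) in bu
  ... | true  = force-from-boundary⇒2n∸1≤Φ T u w u∈T others-black bu
  ... | false = ≤-trans (2n∸1≤Φ _ rest) (≤-reflexive (force-inside-block-preserves-Φ T u w u∈T u~w others-black bu))

  zeroForcingSet-lowerBound : ∀ S → IsZeroForcingSet H S → 2 * n ∸ 1 ≤ ∣ S ∣
  zeroForcingSet-lowerBound S forcing = ≤-trans (2n∸1≤Φ S forcing) (Φ≤∣∣ S)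

  module UpperBound (M : ℕ) (M<L : M < L) (hubAt-M : hubAt M ≡ true)
                    (no-hub-after : ∀ i → M < i → i < L → hubAt i ≡ false) where

    followsHub : ℕ → Bool
    followsHub zero    = false
    followsHub (suc i) = hubAt i

    count-followsHub : ∀ m → m ≤ L → hubAt m ≡ true → count m followsHub ≡ count m hubAt
    count-followsHub zero    _   _ = refl
    count-followsHub (suc m) m<L h = sym (begin
      count (suc m) hubAt          ≡⟨ count-snoc m hubAt ⟩
      count m hubAt + bit (hubAt m) ≡⟨ cong (λ b → count m hubAt + bit b) hub-before ⟩
      count m hubAt + 0            ≡⟨ +-identityʳ _ ⟩
      count m hubAt                ∎)
      where
      open ≡-Reasoning
      hub-before : hubAt m ≡ false
      hub-before with hubAt m in hm
      ... | true  = ⊥-elim (true≢false (trans (sym h) (no-hub-loop m m<L hm)))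
      ... | false = refl

    -- The first two edges of each cycle before the last visit M of the hub, and the
    -- last edge.
    seed : ℕ → Bool
    seed i = (does (i <? M) ∧ (hubAt i ∨ followsHub i)) ∨ does (i ≟ pred L)

    count-hubAt-before-M : count M hubAt + 1 ≡ n
    count-hubAt-before-M = begin
      count M hubAt + 1                                   ≡⟨ cong (count M hubAt +_) last-cycle ⟨
      count M hubAt + count (suc r) (λ i → hubAt (M + i)) ≡⟨ count-++ M (suc r) hubAt ⟨
      count (M + suc r) hubAt                             ≡⟨ cong (λ m → count m hubAt) M+1+r≡L ⟩
      count L hubAt                                       ≡⟨ hub-visits ⟩
      n                                                   ∎
      where
      open ≡-Reasoning
      r : ℕ
      r = L ∸ suc M
      M+1+r≡L : M + suc r ≡ L
      M+1+r≡L = trans (+-suc M r) (m+[n∸m]≡n M<L)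
      last-cycle : count (suc r) (λ i → hubAt (M + i)) ≡ 1
      last-cycle rewrite +-identityʳ M | hubAt-M =
        cong suc (count-zero r (λ i i<r → no-hub-after (M + suc i) (m<m+n M z<s)
                                            (subst (M + suc i <_) M+1+r≡L (+-monoʳ-< M (s<s i<r)))))

    count-seed : count L seed ≤ 2 * n ∸ 1
    count-seed = begin
      count L seed
        ≤⟨ count-∨ L _ (λ i → does (i ≟ pred L)) ⟩
      count L (λ i → does (i <? M) ∧ (hubAt i ∨ followsHub i)) + count L (λ i → does (i ≟ pred L))
        ≤⟨ +-mono-≤ (≤-reflexive (count-<?-∧ M L _ (<⇒≤ M<L))) (count-≟≤1 L (pred L)) ⟩
      count M (λ i → hubAt i ∨ followsHub i) + 1
        ≤⟨ +-monoˡ-≤ 1 (count-∨ M hubAt followsHub) ⟩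
      count M hubAt + count M followsHub + 1
        ≡⟨ cong (λ c → count M hubAt + c + 1) (count-followsHub M (<⇒≤ M<L) hubAt-M) ⟩
      count M hubAt + count M hubAt + 1
        ≡⟨ cong (_∸ 1) (double+1 (count M hubAt)) ⟨
      2 * (count M hubAt + 1) ∸ 1
        ≡⟨ cong (λ k → 2 * k ∸ 1) count-hubAt-before-M ⟩
      2 * n ∸ 1 ∎
      where
      open ≤-Reasoning
      double+1 : ∀ a → 2 * (a + 1) ≡ suc (a + a + 1)
      double+1 = solve-∀

    stage : ℕ → Subset L
    stage z = fromPred L (λ i → seed i ∨ does (i <? z))

    stage-L : stage L ≡ ⊤
    stage-L = χ-injective _ _ λ i i<L →
      trans (χ-fromPred L _ i i<L) (trans (∨-introʳ (seed i) (dec-true (i <? L) i<L)) (sym (χ-⊤ L i i<L)))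

    stage-seed : ∀ z → seed z ≡ true → stage z ≡ stage (suc z)
    stage-seed z seed-z = χ-injective _ _ λ i i<L → begin
      χ (stage z) i                               ≡⟨ χ-fromPred L _ i i<L ⟩
      seed i ∨ does (i <? z)                      ≡⟨ absorb i ⟩
      seed i ∨ (does (i <? z) ∨ does (i ≟ z))     ≡⟨ cong (seed i ∨_) (<?-suc i z) ⟨
      seed i ∨ does (i <? suc z)                  ≡⟨ χ-fromPred L _ i i<L ⟨
      χ (stage (suc z)) i                         ∎
      where
      open ≡-Reasoning
      absorb : ∀ i → seed i ∨ does (i <? z) ≡ seed i ∨ (does (i <? z) ∨ does (i ≟ z))
      absorb i with i ≟ z
      ... | yes refl rewrite seed-z = refl
      ... | no  i≢z  = sym (trans (cong (λ b → seed i ∨ (does (i <? z) ∨ b)) (dec-false (i ≟ z) i≢z))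
                                  (cong (seed i ∨_) (∨-identityʳ (does (i <? z)))))

    stage-force : ∀ z (w : Fin L) → toℕ w ≡ z → stage z ∪ ⁅ w ⁆ ≡ stage (suc z)
    stage-force z w w≡z = χ-injective _ _ λ i i<L → begin
      χ (stage z ∪ ⁅ w ⁆) i                       ≡⟨ χ-∪-⁅⁆ (stage z) w i ⟩
      χ (stage z) i ∨ does (i ≟ toℕ w)            ≡⟨ cong₂ (λ b k → b ∨ does (i ≟ k)) (χ-fromPred L _ i i<L) w≡z ⟩
      (seed i ∨ does (i <? z)) ∨ does (i ≟ z)     ≡⟨ ∨-assoc (seed i) _ _ ⟩
      seed i ∨ (does (i <? z) ∨ does (i ≟ z))     ≡⟨ cong (seed i ∨_) (<?-suc i z) ⟨
      seed i ∨ does (i <? suc z)                  ≡⟨ χ-fromPred L _ i i<L ⟨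
      χ (stage (suc z)) i                         ∎
      where open ≡-Reasoning

    0<M : 0 < M
    0<M = n≢0⇒n>0 λ M≡0 →
      <⇒≱ 2≤n (≤-reflexive (trans (sym count-hubAt-before-M) (cong (λ m → count m hubAt + 1) M≡0)))

    seed-0 : seed 0 ≡ true
    seed-0 = ∨-introˡ _ (∧-intro (dec-true (0 <? M) 0<M) (∨-introˡ _ hubAt-0))

    seed-last : seed (pred L) ≡ true
    seed-last = ∨-introʳ _ (dec-true (pred L ≟ pred L) refl)

    boundary-after-M-is-last : ∀ x → M < x → x < L → boundary hubAt x ≡ true → x ≡ pred L
    boundary-after-M-is-last x M<x x<L bx with suc x <? L
    ... | yes 1+x<L = ⊥-elim (true≢false (trans (sym bx) (cong₂ _∨_ (no-hub-after x M<x x<L)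
                                                                  (no-hub-after (suc x) (<-trans M<x (n<1+n x)) 1+x<L))))
    ... | no  1+x≮L = cong pred (sym (≤-antisym (≮⇒≥ 1+x≮L) x<L))

    M≤1+y : ∀ y → boundary hubAt y ≡ true → seed (suc y) ≡ false → M ≤ suc y
    M≤1+y y by seed-false = ≮⇒≥ λ 1+y<M → true≢false (begin
      true                                                     ≡⟨ dec-true (suc y <? M) 1+y<M ⟨
      does (suc y <? M)                                        ≡⟨ ∧-identityʳ _ ⟨
      does (suc y <? M) ∧ true
        ≡⟨ cong (does (suc y <? M) ∧_) (trans (sym by) (∨-comm (hubAt y) (hubAt (suc y)))) ⟩
      does (suc y <? M) ∧ (hubAt (suc y) ∨ followsHub (suc y)) ≡⟨ ∨-conicalˡ _ _ seed-false ⟩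
      false                                                    ∎)
      where open ≡-Reasoning

    black-below : ∀ z i → i < L → i < z → χ (stage z) i ≡ true
    black-below z i i<L i<z = trans (χ-fromPred L _ i i<L) (∨-introʳ (seed i) (dec-true (i <? z) i<z))

    forcer-neighbours-black : ∀ y → seed (suc y) ≡ false →
                              ∀ i → i < L → i ≢ y → i ≢ suc y → Meeting y i → χ (stage (suc y)) i ≡ true
    forcer-neighbours-black y _          i _   i≢y _     (same e)      = ⊥-elim (i≢y (sym e))
    forcer-neighbours-black y _          i _   _   i≢1+y (next e)      = ⊥-elim (i≢1+y (sym e))
    forcer-neighbours-black y _          i i<L _   _     (prev e)      = black-below (suc y) i i<L (≤-trans (≤-reflexive e) (n≤1+n y))
    forcer-neighbours-black y seed-false i i<L _   i≢1+y (atHub by bi) with i <? suc y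
    ... | yes i<1+y = black-below (suc y) i i<L i<1+y
    ... | no  i≮1+y = trans (χ-fromPred L _ i i<L) (∨-introˡ _ (subst (λ k → seed k ≡ true) (sym i≡last) seed-last))
      where
      i≡last : i ≡ pred L
      i≡last = boundary-after-M-is-last i
                 (≤-<-trans (M≤1+y y by seed-false) (≤∧≢⇒< (≮⇒≥ i≮1+y) (i≢1+y ∘ sym))) i<L bi

    stage-forces : ∀ y (p : suc y < L) → seed (suc y) ≡ false →
                   ForceStep H (stage (suc y)) (stage (suc y) ∪ ⁅ fromℕ< p ⁆)
    stage-forces y p seed-false = force u w u∈ w∉ u~w others-black
      where
      y<L : y < L
      y<L = <-trans (n<1+n y) p
      u w : Fin L
      u = fromℕ< y<L
      w = fromℕ< p
      u≡y : toℕ u ≡ y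
      u≡y = toℕ-fromℕ< y<L
      w≡1+y : toℕ w ≡ suc y
      w≡1+y = toℕ-fromℕ< p
      u∈ : u ∈ stage (suc y)
      u∈ = χ⇒∈ u _ (trans (cong (χ (stage (suc y))) u≡y) (black-below (suc y) y y<L ≤-refl))
      w∉ : w ∉ stage (suc y)
      w∉ w∈ = true≢false (begin
        true                                ≡⟨ ∈⇒χ w∈ ⟨
        χ (stage (suc y)) (toℕ w)           ≡⟨ cong (χ (stage (suc y))) w≡1+y ⟩
        χ (stage (suc y)) (suc y)           ≡⟨ χ-fromPred L _ (suc y) p ⟩
        seed (suc y) ∨ does (suc y <? suc y) ≡⟨ cong₂ _∨_ seed-false (dec-false (suc y <? suc y) (n≮n (suc y))) ⟩
        false                               ∎)
        where open ≡-Reasoning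
      u~w : Adj H u w
      u~w = meet⇒adjacent (λ e → 1+n≢n (sym (trans (sym u≡y) (trans e w≡1+y))))
                          (subst₂ Meet (sym u≡y) (sym w≡1+y) (inj₂ (inj₁ refl)))
      others-black : ∀ x → Adj H u x → x ≢ w → x ∈ stage (suc y)
      others-black x u~x x≢w = χ⇒∈ x _ (forcer-neighbours-black y seed-false (toℕ x) (toℕ<n x)
        (λ e → proj₁ u~x (toℕ-injective (trans u≡y (sym e))))
        (λ e → x≢w (toℕ-injective (trans e (sym w≡1+y))))
        (meeting y (toℕ x) (subst (λ U → Meet U (toℕ x)) u≡y (adjacent⇒meet u~x))))

    stage-step : ∀ z → z < L → Star (ForceStep H) (stage (suc z)) ⊤ → Star (ForceStep H) (stage z) ⊤
    stage-step zero    _ rest = subst (λ T → Star (ForceStep H) T ⊤) (sym (stage-seed 0 seed-0)) rest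
    stage-step (suc y) p rest with seed (suc y) in seed-1+y
    ... | true  = subst (λ T → Star (ForceStep H) T ⊤) (sym (stage-seed (suc y) seed-1+y)) rest
    ... | false = stage-forces y p seed-1+y ◅
                  subst (λ T → Star (ForceStep H) T ⊤) (sym (stage-force (suc y) (fromℕ< p) (toℕ-fromℕ< p))) rest

    stages-force-all : ∀ d z → d + z ≡ L → Star (ForceStep H) (stage z) ⊤
    stages-force-all zero    z z≡L   = subst (λ T → Star (ForceStep H) T ⊤) (sym (trans (cong stage z≡L) stage-L)) ε
    stages-force-all (suc d) z d+z≡L = stage-step z (≤-trans (s≤s (m≤n+m z d)) (≤-reflexive d+z≡L))
                                         (stages-force-all d (suc z) (trans (+-suc d z) d+z≡L))

    zeroForcingNumber : ZeroForcingNumberIs H (2 * n ∸ 1)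
    zeroForcingNumber = (stage 0 , forcing , ≤-antisym size≤ (zeroForcingSet-lowerBound (stage 0) forcing)) ,
                        zeroForcingSet-lowerBound
      where
      forcing : IsZeroForcingSet H (stage 0)
      forcing = stages-force-all L 0 (+-identityʳ L)
      size≤ : ∣ stage 0 ∣ ≤ 2 * n ∸ 1
      size≤ = begin
        ∣ stage 0 ∣               ≡⟨ ∣∣≡count-χ (stage 0) ⟩
        count L (χ (stage 0))     ≡⟨ count-cong L (λ i i<L → trans (χ-fromPred L _ i i<L) (∨-identityʳ (seed i))) ⟩
        count L seed              ≤⟨ count-seed ⟩
        2 * n ∸ 1                 ∎
        where open ≤-Reasoning

  0<L : 0 < L
  0<L = <-≤-trans z<s (≤-trans 2≤n (≤-trans (≤-reflexive (sym hub-visits)) (count≤ L hubAt)))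

  zeroForcingNumber : ZeroForcingNumberIs H (2 * n ∸ 1)
  zeroForcingNumber with lastTrue L hubAt 0<L hubAt-0
  ... | M , M<L , hubAt-M , no-hub-after = UpperBound.zeroForcingNumber M M<L hubAt-M no-hub-after

applyUpTo-cong : ∀ {A : Set} m {f g : ℕ → A} → (∀ j → j < m → f j ≡ g j) → applyUpTo f m ≡ applyUpTo g m
applyUpTo-cong zero    f≗g = refl
applyUpTo-cong (suc m) f≗g = cong₂ _∷_ (f≗g 0 z<s) (applyUpTo-cong m (λ j j<m → f≗g (suc j) (s<s j<m)))

applyUpTo-+ : ∀ {A : Set} (f : ℕ → A) m n → applyUpTo f (m + n) ≡ applyUpTo f m ++ applyUpTo (f ∘ (m +_)) n
applyUpTo-+ f zero    n = refl
applyUpTo-+ f (suc m) n = cong (f 0 ∷_) (applyUpTo-+ (f ∘ suc) m n)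

lookup-≡applyUpTo : ∀ {A : Set} {xs : List A} f m → xs ≡ applyUpTo f m → ∀ i → List.lookup xs i ≡ f (toℕ i)
lookup-≡applyUpTo f m refl = lookup-applyUpTo f m

pathEdges-applyUpTo : ∀ o m → pathEdges (suc o) m ≡ applyUpTo (λ j → (o + suc j , o + suc (suc j))) m
pathEdges-applyUpTo o zero    = refl
pathEdges-applyUpTo o (suc m) =
  cong₂ _∷_ (cong₂ _,_ (sym (+-comm o 1)) (sym (+-comm o 2)))
            (trans (pathEdges-applyUpTo (suc o) m)
                   (applyUpTo-cong m (λ j _ → cong₂ _,_ (sym (+-suc o (suc j))) (sym (+-suc o (suc (suc j)))))))

edgeCount : List ℕ → ℕ
edgeCount []       = 0
edgeCount (k ∷ ks) = suc k + edgeCount ks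

-- The vertex sequence of the closed walk around the bouquet whose cycles
-- (of lengths k + 1) use the fresh vertices o + 1, o + 2, … in order.
vertex : ℕ → List ℕ → ℕ → ℕ
vertex o []       j       = 0
vertex o (k ∷ ks) zero    = 0
vertex o (k ∷ ks) (suc j) with j <? k
... | yes _ = o + suc j
... | no  _ = vertex (o + k) ks (j ∸ k)

vertex-0 : ∀ o ks → vertex o ks 0 ≡ 0
vertex-0 o []       = refl
vertex-0 o (k ∷ ks) = refl

vertex-inner : ∀ o k ks j → j < k → vertex o (k ∷ ks) (suc j) ≡ o + suc j
vertex-inner o k ks j j<k with j <? k
... | yes _   = refl
... | no  j≮k = ⊥-elim (j≮k j<k)

vertex-beyond : ∀ o k ks j → vertex o (k ∷ ks) (suc (k + j)) ≡ vertex (o + k) ks j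
vertex-beyond o k ks j with k + j <? k
... | yes k+j<k = ⊥-elim (m+n≮m k j k+j<k)
... | no  _     = cong (vertex (o + k) ks) (m+n∸m≡n k j)

data Position (k : ℕ) : ℕ → Set where
  atStart : Position k 0
  inner   : ∀ j → j < k → Position k (suc j)
  beyond  : ∀ j → Position k (suc (k + j))

position : ∀ k i → Position k i
position k zero    = atStart
position k (suc i) with i <? k
... | yes i<k = inner i i<k
... | no  i≮k = subst (Position k ∘ suc) (m+[n∸m]≡n (≮⇒≥ i≮k)) (beyond (i ∸ k))

walkEdge : ℕ → List ℕ → ℕ → Edge
walkEdge o ks j = (vertex o ks j , vertex o ks (suc j))

bouquetEdgesFrom-applyUpTo : ∀ o ks → All (1 ≤_) ks → bouquetEdgesFrom o ks ≡ applyUpTo (walkEdge o ks) (edgeCount ks)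
bouquetEdgesFrom-applyUpTo o []             []         = refl
bouquetEdgesFrom-applyUpTo o (suc k ∷ ks) (_ ∷ 1≤ks) = sym (begin
  applyUpTo E (suc (suc k) + edgeCount ks)
    ≡⟨ applyUpTo-+ E (suc (suc k)) (edgeCount ks) ⟩
  applyUpTo E (suc (suc k)) ++ applyUpTo (E ∘ (suc (suc k) +_)) (edgeCount ks)
    ≡⟨ cong₂ _++_ cycle rest ⟩
  cycleEdges o (suc k) ++ bouquetEdgesFrom (o + suc k) ks ∎)
  where
  open ≡-Reasoning
  E : ℕ → Edge
  E = walkEdge o (suc k ∷ ks)
  last-vertex : vertex o (suc k ∷ ks) (suc (suc k)) ≡ 0
  last-vertex = trans (cong (λ m → vertex o (suc k ∷ ks) (suc m)) (sym (+-identityʳ (suc k))))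
                      (trans (vertex-beyond o (suc k) ks 0) (vertex-0 (o + suc k) ks))
  cycle : applyUpTo E (suc (suc k)) ≡ cycleEdges o (suc k)
  cycle = cong₂ _∷_ (cong (0 ,_) (trans (vertex-inner o (suc k) ks 0 z<s) (+-comm o 1)))
    (begin
      applyUpTo (E ∘ suc) (suc k)              ≡⟨ applyUpTo-∷ʳ (E ∘ suc) k ⟨
      applyUpTo (E ∘ suc) k ++ [ E (suc k) ]   ≡⟨ cong₂ (λ xs e → xs ++ [ e ]) path
                                                         (cong₂ _,_ (vertex-inner o (suc k) ks k ≤-refl) last-vertex) ⟩
      pathEdges (suc o) k ++ [ (o + suc k , 0) ] ∎)
    where
    path : applyUpTo (E ∘ suc) k ≡ pathEdges (suc o) k
    path = trans (applyUpTo-cong k (λ j j<k → cong₂ _,_ (vertex-inner o (suc k) ks j (m<n⇒m<1+n j<k))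
                                                         (vertex-inner o (suc k) ks (suc j) (s<s j<k))))
                 (sym (pathEdges-applyUpTo o k))
  rest : applyUpTo (E ∘ (suc (suc k) +_)) (edgeCount ks) ≡ bouquetEdgesFrom (o + suc k) ks
  rest = trans (applyUpTo-cong (edgeCount ks) (λ j _ → cong₂ _,_
                  (vertex-beyond o (suc k) ks j)
                  (trans (cong (λ m → vertex o (suc k ∷ ks) (suc m)) (sym (+-suc (suc k) j)))
                         (vertex-beyond o (suc k) ks (suc j)))))
               (sym (bouquetEdgesFrom-applyUpTo (o + suc k) ks 1≤ks))

vertex-after-end : ∀ o ks j → edgeCount ks ≤ j → vertex o ks j ≡ 0
vertex-after-end o []       j _ = refl
vertex-after-end o (k ∷ ks) j end≤j with position k j
... | atStart   = refl
... | inner i i<k = ⊥-elim (<⇒≱ i<k (≤-trans (m≤m+n k _) (≤-pred end≤j)))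
... | beyond i  = trans (vertex-beyond o k ks i) (vertex-after-end (o + k) ks i (+-cancelˡ-≤ k _ _ (≤-pred end≤j)))

vertex-≢0⇒> : ∀ o ks j → vertex o ks j ≢ 0 → o < vertex o ks j
vertex-≢0⇒> o []       j v≢0 = ⊥-elim (v≢0 refl)
vertex-≢0⇒> o (k ∷ ks) j v≢0 with position k j
... | atStart     = ⊥-elim (v≢0 refl)
... | inner i i<k rewrite vertex-inner o k ks i i<k = m<m+n o z<s
... | beyond i    rewrite vertex-beyond o k ks i = ≤-trans (s≤s (m≤m+n o k)) (vertex-≢0⇒> (o + k) ks i v≢0)

vertex-injective : ∀ o ks i j → vertex o ks i ≡ vertex o ks j → vertex o ks i ≢ 0 → i ≡ j
vertex-injective o []       i j _ v≢0 = ⊥-elim (v≢0 refl)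
vertex-injective o (k ∷ ks) i j vi≡vj vi≢0 = by-position (position k i) (position k j) vi≡vj vi≢0
  where
  w : ℕ → ℕ
  w = vertex o (k ∷ ks)
  inner≤ : ∀ i → i < k → w (suc i) ≤ o + k
  inner≤ i i<k rewrite vertex-inner o k ks i i<k = +-monoʳ-≤ o i<k
  beyond> : ∀ i → w (suc (k + i)) ≢ 0 → o + k < w (suc (k + i))
  beyond> i v≢0 rewrite vertex-beyond o k ks i = vertex-≢0⇒> (o + k) ks i v≢0
  by-position : ∀ {i j} → Position k i → Position k j → w i ≡ w j → w i ≢ 0 → i ≡ j
  by-position atStart        _              _     v≢0 = ⊥-elim (v≢0 refl)
  by-position (inner i _)    atStart        vi≡vj v≢0 = ⊥-elim (v≢0 vi≡vj)
  by-position (beyond i)     atStart        vi≡vj v≢0 = ⊥-elim (v≢0 vi≡vj)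
  by-position (inner i i<k) (inner j j<k)   vi≡vj _   =
    cong suc (suc-injective (+-cancelˡ-≡ o _ _ (trans (sym (vertex-inner o k ks i i<k)) (trans vi≡vj (vertex-inner o k ks j j<k)))))
  by-position (inner i i<k) (beyond j)      vi≡vj v≢0 =
    ⊥-elim (<⇒≱ (beyond> j (v≢0 ∘ trans vi≡vj)) (≤-trans (≤-reflexive (sym vi≡vj)) (inner≤ i i<k)))
  by-position (beyond i)    (inner j j<k)   vi≡vj v≢0 =
    ⊥-elim (<⇒≱ (beyond> i v≢0) (≤-trans (≤-reflexive vi≡vj) (inner≤ j j<k)))
  by-position (beyond i)    (beyond j)      vi≡vj v≢0 =
    cong (suc ∘ (k +_)) (vertex-injective (o + k) ks i j
      (trans (sym (vertex-beyond o k ks i)) (trans vi≡vj (vertex-beyond o k ks j)))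
      (v≢0 ∘ trans (vertex-beyond o k ks i)))

vertex-inner-≢0 : ∀ o k ks j → j < k → vertex o (k ∷ ks) (suc j) ≢ 0
vertex-inner-≢0 o k ks j j<k rewrite vertex-inner o k ks j j<k | +-suc o j = λ ()

vertex-no-hub-loop : ∀ o ks → All (1 ≤_) ks → NoAdjacentStarts (edgeCount ks) (isZero ∘ vertex o ks)
vertex-no-hub-loop o (k ∷ ks) (1≤k ∷ 1≤ks) i i<end hub-i with position k i
... | atStart     = isZero-≢0 (vertex-inner-≢0 o k ks 0 1≤k)
... | inner j j<k = ⊥-elim (true≢false (trans (sym hub-i) (isZero-≢0 (vertex-inner-≢0 o k ks j j<k))))
... | beyond j    = begin
  isZero (vertex o (k ∷ ks) (suc (suc (k + j))))  ≡⟨ cong (isZero ∘ vertex o (k ∷ ks) ∘ suc) (+-suc k j) ⟨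
  isZero (vertex o (k ∷ ks) (suc (k + suc j)))    ≡⟨ cong isZero (vertex-beyond o k ks (suc j)) ⟩
  isZero (vertex (o + k) ks (suc j))              ≡⟨ vertex-no-hub-loop (o + k) ks 1≤ks j (+-cancelˡ-< k _ _ (≤-pred i<end))
                                                       (trans (cong isZero (sym (vertex-beyond o k ks j))) hub-i) ⟩
  false                                           ∎
  where open ≡-Reasoning

count-hub-vertices : ∀ o ks → count (edgeCount ks) (isZero ∘ vertex o ks) ≡ length ks
count-hub-vertices o []       = refl
count-hub-vertices o (k ∷ ks) = begin
  count (suc k + edgeCount ks) (isZero ∘ vertex o (k ∷ ks))
    ≡⟨ count-++ (suc k) (edgeCount ks) (isZero ∘ vertex o (k ∷ ks)) ⟩
  suc (count k (λ j → isZero (vertex o (k ∷ ks) (suc j)))) + count (edgeCount ks) (λ j → isZero (vertex o (k ∷ ks) (suc (k + j))))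
    ≡⟨ cong₂ (λ a b → suc a + b) (count-zero k (λ j j<k → isZero-≢0 (vertex-inner-≢0 o k ks j j<k)))
                                 (count-cong (edgeCount ks) (λ j _ → cong isZero (vertex-beyond o k ks j))) ⟩
  suc (count (edgeCount ks) (isZero ∘ vertex (o + k) ks))
    ≡⟨ cong suc (count-hub-vertices (o + k) ks) ⟩
  length (k ∷ ks) ∎
  where open ≡-Reasoning

bouquet-zeroForcingNumber : ∀ ks → All (1 ≤_) ks → 2 ≤ length ks →
                            ZeroForcingNumberIs (LineGraph (bouquetEdges ks)) (2 * length ks ∸ 1)
bouquet-zeroForcingNumber ks 1≤ks 2≤n =
  HubWalk.zeroForcingNumber (bouquetEdges ks) (vertex 0 ks) (length ks)
    (lookup-≡applyUpTo (walkEdge 0 ks) (edgeCount ks) edges≡)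
    (vertex-0 0 ks)
    (λ j end≤j → vertex-after-end 0 ks j (subst (_≤ j) length≡ end≤j))
    (vertex-injective 0 ks)
    (λ i i<end → vertex-no-hub-loop 0 ks 1≤ks i (subst (i <_) length≡ i<end))
    (trans (cong (λ m → count m (isZero ∘ vertex 0 ks)) length≡) (count-hub-vertices 0 ks))
    2≤n
  where
  edges≡ : bouquetEdges ks ≡ applyUpTo (walkEdge 0 ks) (edgeCount ks)
  edges≡ = bouquetEdgesFrom-applyUpTo 0 ks 1≤ks
  length≡ : length (bouquetEdges ks) ≡ edgeCount ks
  length≡ = trans (cong length edges≡) (length-applyUpTo (walkEdge 0 ks) (edgeCount ks))

all-positive : ∀ {n} (k : Vec ℕ n) → (∀ i → 2 ≤ lookup k i) → All (1 ≤_) (toList k)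
all-positive []      _   = []
all-positive (x ∷ k) 2≤k = ≤-trans (s≤s z≤n) (2≤k fzero) ∷ all-positive k (2≤k ∘ fsuc)

theorem3p20 : (n : ℕ) → 2 Data.Nat.≤ n → (k : Vec ℕ n) →
    (∀ i → 2 Data.Nat.≤ lookup k i) →
    (∀ i j → i Data.Fin.≤ j → lookup k i Data.Nat.≤ lookup k j) →
    ZeroForcingNumberIs (LineGraph (bouquetEdges (toList k))) (2 * n ∸ 1)
theorem3p20 n 2≤n k 2≤k _ =
  subst (λ m → ZeroForcingNumberIs (LineGraph (bouquetEdges (toList k))) (2 * m ∸ 1)) (length-toList k)
    (bouquet-zeroForcingNumber (toList k) (all-positive k 2≤k) (subst (2 ≤_) (sym (length-toList k)) 2≤n))
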